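{- Let $T$ be a tree, $w\colon V(T)\to\mathbb{Z}_{>0}$ a positive integral weight function, and $M$ a positive integer. Then $\mathrm{td}(G_M(T,w)) = M\cdot \mathrm{td}(T,w)$.
   Context: A treedepth decomposition of a graph $G$ is a rooted forest $F$ with $V(F)=V(G)$ such that for every edge $uv\in E(G)$, $u$ is an ancestor of $v$ in $F$ or vice versa. The height of a rooted forest is the maximum number of vertices on a root-to-leaf path; $\mathrm{td}(G)$ is the minimum height of a treedepth decomposition of $G$. For a graph $G$ with vertex weights $w$, $\mathrm{td}(G,w)$ is the minimum integer $k$ such that there is a treedepth decomposition of $G$ in which, on every vertical path (path of pairwise ancestor-comparable vertices), the sum of weights of the vertices is at most $k$. For a tree $T$ with weights $w$ and a positive integer $M$, the graph $G_M(T,w)$ is constructed as follows: for each $x\in V(T)$ create a set $V_x$ of $w(x)\cdot M$ vertices forming a clique, and for each edge $xy\in E(T)$ add all edges between $V_x$ and $V_y$. -}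

module Defs where

open import Level using (0ℓ)
open import Data.Nat using (ℕ; zero; suc; _+_; _*_; _≤_; _<_)
open import Data.Fin using (Fin)
open import Data.Maybe using (Maybe; just; nothing)
open import Data.List using (List; []; _∷_; map; length)
open import Data.Nat.ListAction using (sum)
open import Data.List.Relation.Unary.Unique.Propositional using (Unique)
open import Data.List.Relation.Unary.AllPairs using (AllPairs)
open import Data.Product using (Σ; _×_; _,_; ∃)
open import Data.Sum using (_⊎_)
open import Relation.Nullary using (¬_)
open import Relation.Binary.PropositionalEquality using (_≡_; _≢_)

record Graph (V : Set) : Set₁ where
  field
    Adj   : V → V → Set
    sym   : ∀ {u v} → Adj u v → Adj v u
    irrefl : ∀ {u} → ¬ Adj u u
open Graph public

data Walk {V : Set} (G : Graph V) : V → V → Set where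
  here : ∀ {u} → Walk G u u
  step : ∀ {u v x} → Adj G u v → Walk G v x → Walk G u x

Connected : {V : Set} → Graph V → Set
Connected {V} G = ∀ (u v : V) → Walk G u v

Consec : {V : Set} → Graph V → List V → Set
Consec G []            = Data.Unit.⊤ where import Data.Unit
Consec G (x ∷ [])      = Data.Unit.⊤ where import Data.Unit
Consec G (x ∷ y ∷ xs)  = Adj G x y × Consec G (y ∷ xs)

last : {V : Set} → V → List V → V
last x []       = x
last x (y ∷ ys) = last y ys

IsCycle : {V : Set} → Graph V → V → List V → Set
IsCycle G v vs = Unique (v ∷ vs) × (2 ≤ length vs) × Consec G (v ∷ vs)
                 × Adj G (last v vs) v

Acyclic : {V : Set} → Graph V → Set
Acyclic {V} G = ∀ (v : V) (vs : List V) → ¬ IsCycle G v vs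

IsTree : ∀ {n} → Graph (Fin n) → Set
IsTree G = Connected G × Acyclic G

-- Rooted forests on a vertex type V, given by a parent map;
-- roots have no parent.  Acyclicity of the parent map is witnessed by a
-- depth function strictly increasing from parent to child.
record RootedForest (V : Set) : Set where
  field
    parent : V → Maybe V
    depth  : V → ℕ
    depth-parent : ∀ {u v} → parent v ≡ just u → depth u < depth v
open RootedForest public

-- Ancestor u v : u is an ancestor of v (reflexively: every vertex is its own ancestor).
data Ancestor {V : Set} (F : RootedForest V) : V → V → Set where
  self : ∀ {u} → Ancestor F u u
  up   : ∀ {u p v} → parent F v ≡ just p → Ancestor F u p → Ancestor F u v

Comparable : {V : Set} → RootedForest V → V → V → Set
Comparable F u v = Ancestor F u v ⊎ Ancestor F v u

IsTDDecomp : {V : Set} → Graph V → RootedForest V → Set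
IsTDDecomp {V} G F = ∀ {u v : V} → Adj G u v → Comparable F u v

IsVertical : {V : Set} → RootedForest V → List V → Set
IsVertical F vs = Unique vs × AllPairs (Comparable F) vs

weightOf : {V : Set} → (V → ℕ) → List V → ℕ
weightOf w vs = sum (map w vs)

TDAtMost : {V : Set} → Graph V → (V → ℕ) → ℕ → Set
TDAtMost {V} G w k =
  Σ (RootedForest V) λ F → IsTDDecomp G F ×
    (∀ (vs : List V) → IsVertical F vs → weightOf w vs ≤ k)

IsWeightedTD : {V : Set} → Graph V → (V → ℕ) → ℕ → Set
IsWeightedTD G w k = TDAtMost G w k × (∀ k′ → TDAtMost G w k′ → k ≤ k′)

IsTD : {V : Set} → Graph V → ℕ → Set
IsTD G k = IsWeightedTD G (λ _ → 1) k

-- The blow-up G_M(T, w): vertex x of T becomes a clique V_x of w(x)·M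
-- vertices, and edges of T become complete bipartite joins.
GM-V : ∀ {n} → (Fin n → ℕ) → ℕ → Set
GM-V {n} w M = Σ (Fin n) λ x → Fin (w x * M)

GM-Adj : ∀ {n} (T : Graph (Fin n)) (w : Fin n → ℕ) (M : ℕ) →
         GM-V w M → GM-V w M → Set
GM-Adj T w M (x , i) (y , j) = (Σ (x ≡ y) λ _ → ¬ (_≡_ {A = GM-V w M} (x , i) (y , j)))
                               ⊎ Adj T x y

GM : ∀ {n} → Graph (Fin n) → (w : Fin n → ℕ) → (M : ℕ) → Graph (GM-V w M)
GM T w M = record
  { Adj = GM-Adj T w M
  ; sym = λ where
      (Data.Sum.inj₁ (refl , ne)) → Data.Sum.inj₁ (refl , λ e → ne (Relation.Binary.PropositionalEquality.sym e))
      (Data.Sum.inj₂ a) → Data.Sum.inj₂ (Graph.sym T a)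
  ; irrefl = λ where
      (Data.Sum.inj₁ (_ , ne)) → ne refl
      (Data.Sum.inj₂ a) → Graph.irrefl T a
  }
  where
  import Data.Sum
  import Relation.Binary.PropositionalEquality
  open Relation.Binary.PropositionalEquality using (refl)

{-# OPTIONS --safe #-}
module Submission where

-- Given a decomposition F of T, replacing every x by a chain through the w(x)·M vertices of V_x,
-- hung below the chain of its parent, decomposes G_M; a vertical path of the new forest lies in
-- the blocks of a vertical path of F, so td(G_M) ≤ M·td(T,w). Conversely, in a decomposition of
-- G_M every clique V_x is a chain. Ordering the vertices of T by the ancestry of the lowest
-- vertices of their blocks decomposes T, and the blocks of a vertical path of weight s form a
-- vertical path of M·s vertices of G_M, so M·td(T,w) ≤ td(G_M).
-- Neither direction needs T to be a tree: acyclicity and connectivity are only used to decide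
-- adjacency in T, which makes td(T,w) ≤ k decidable (a forest on Fin n is determined by a
-- parent and a depth function into finite sets) and lets us compute the least such k.

open import Defs hiding (sym)
open import Data.Nat as ℕ using (ℕ; zero; suc; _+_; _*_; _≤_; _<_; _<?_; _≤?_; z≤n; s≤s; NonZero; >-nonZero)
open import Data.Nat.Properties
open import Data.Nat.DivMod using (_/_; m*n/n≡m; /-monoˡ-≤; m/n*n≤m)
open import Data.Nat.ListAction using (sum)
open import Data.Nat.ListAction.Properties using (sum-++; sum-↭)
open import Data.Fin as Fin using (Fin; toℕ; fromℕ<; finToFun; funToFin)
import Data.Fin.Properties as Finₚ
open import Data.Product using (Σ; _×_; _,_; proj₁; proj₂; ∃)
open import Data.Product.Properties using (≡-dec)
open import Data.Sum using (_⊎_; inj₁; inj₂)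
open import Data.Maybe as Maybe using (Maybe; just; nothing)
open import Data.Maybe.Properties using (just-injective)
open import Data.List using (List; []; _∷_; _++_; map; concatMap; length; filter; allFin)
open import Data.List.Properties using (map-++; length-map; length-tabulate; filter-notAll)
open import Data.List.Relation.Unary.All as All using (All; []; _∷_)
open import Data.List.Relation.Unary.Any as Any using (here; there)
open import Data.List.Relation.Unary.AllPairs as AllPairs using (AllPairs; []; _∷_)
open import Data.List.Relation.Unary.Unique.Propositional using (Unique)
open import Data.List.Relation.Binary.Subset.Propositional using (_⊆_)
open import Data.List.Relation.Binary.Permutation.Propositional using (_↭_)
import Data.List.Relation.Binary.Permutation.Propositional.Properties as ↭
open import Data.List.Membership.Propositional using (_∈_)
open import Data.List.Membership.Propositional.Properties
  using (∈-∃++; ∈-filter⁺; ∈-filter⁻; ∈-allFin; ∈-map⁺; ∈-map⁻; ∈-concatMap⁺; ∈-concatMap⁻)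
open import Data.List.Relation.Unary.All.Properties using (all-filter; ¬Any⇒All¬)
import Data.List.Relation.Unary.Unique.Propositional.Properties as Unique
open import Data.List.Extrema.Nat using (argmax; argmax-sel; f[⊥]≤f[argmax]; f[xs]≤f[argmax])
open import Induction.WellFounded using (Acc; acc)
open import Data.Nat.Induction using (<-wellFounded)
open import Relation.Nullary using (¬_; Dec; yes; no; contradiction; _⊎-dec_; _×-dec_; _→-dec_)
import Relation.Nullary.Decidable as Dec
open import Relation.Binary.Definitions using (DecidableEquality)
open import Relation.Binary.PropositionalEquality
open import Function using (_∘_; id)

module _ {A : Set} (w : A → ℕ) where

  weightOf-++ : ∀ xs ys → weightOf w (xs ++ ys) ≡ weightOf w xs + weightOf w ys
  weightOf-++ xs ys = trans (cong sum (map-++ w xs ys)) (sum-++ (map w xs) (map w ys))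

  weightOf-↭ : {xs ys : List A} → xs ↭ ys → weightOf w xs ≡ weightOf w ys
  weightOf-↭ p = sum-↭ (↭.map⁺ w p)

  ∈⇒≤weightOf : {x : A} {xs : List A} → x ∈ xs → w x ≤ weightOf w xs
  ∈⇒≤weightOf {xs = x ∷ xs} (here refl) = m≤m+n (w x) _
  ∈⇒≤weightOf {xs = x ∷ xs} (there p) = ≤-trans (∈⇒≤weightOf p) (m≤n+m _ (w x))

∈⇒↭∷ : {A : Set} {x : A} {ys : List A} → x ∈ ys → ∃ λ ys′ → ys ↭ x ∷ ys′
∈⇒↭∷ x∈ys with ys₁ , ys₂ , refl ← ∈-∃++ x∈ys = ys₁ ++ ys₂ , ↭.shift _ ys₁ ys₂

weightOf-mono-⊆ : {A : Set} (w : A → ℕ) {xs ys : List A} → Unique xs → xs ⊆ ys →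
                  weightOf w xs ≤ weightOf w ys
weightOf-mono-⊆ w {[]} _ _ = z≤n
weightOf-mono-⊆ w {x ∷ xs} {ys} (x∉xs ∷ xs!) xs⊆ys with ys′ , ys↭ ← ∈⇒↭∷ (xs⊆ys (here refl)) =
  begin
    w x + weightOf w xs   ≤⟨ +-monoʳ-≤ (w x) (weightOf-mono-⊆ w xs! xs⊆ys′) ⟩
    w x + weightOf w ys′  ≡⟨ weightOf-↭ w ys↭ ⟨
    weightOf w ys         ∎
  where
  open ≤-Reasoning
  xs⊆ys′ : xs ⊆ ys′
  xs⊆ys′ z∈xs with ↭.∈-resp-↭ ys↭ (xs⊆ys (there z∈xs))
  ... | here refl = contradiction refl (All.lookup x∉xs z∈xs)
  ... | there z∈ys′ = z∈ys′

weightOf-const : {A : Set} (xs : List A) → weightOf (λ _ → 1) xs ≡ length xs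
weightOf-const [] = refl
weightOf-const (_ ∷ xs) = cong suc (weightOf-const xs)

length-mono-⊆ : {A : Set} {xs ys : List A} → Unique xs → xs ⊆ ys → length xs ≤ length ys
length-mono-⊆ {xs = xs} {ys} xs! xs⊆ys =
  subst₂ _≤_ (weightOf-const xs) (weightOf-const ys) (weightOf-mono-⊆ (λ _ → 1) xs! xs⊆ys)

module _ {A : Set} (f : A → ℕ) where

  argmaxᴹ : List A → Maybe A
  argmaxᴹ [] = nothing
  argmaxᴹ (x ∷ xs) = just (argmax f x xs)

  argmaxᴹ-∈ : ∀ {xs z} → argmaxᴹ xs ≡ just z → z ∈ xs
  argmaxᴹ-∈ {x ∷ xs} refl with argmax-sel f x xs
  ... | inj₁ ≡x = here ≡x
  ... | inj₂ ∈xs = there ∈xs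

  argmaxᴹ-maximal : ∀ {xs y z} → argmaxᴹ xs ≡ just z → y ∈ xs → f y ≤ f z
  argmaxᴹ-maximal {x ∷ xs} refl (here refl) = f[⊥]≤f[argmax] {f = f} x xs
  argmaxᴹ-maximal {x ∷ xs} refl (there y∈xs) = All.lookup (f[xs]≤f[argmax] {f = f} x xs) y∈xs

  argmaxᴹ-just : ∀ {xs y} → y ∈ xs → ∃ λ z → argmaxᴹ xs ≡ just z
  argmaxᴹ-just {x ∷ xs} _ = argmax f x xs , refl

-- Rooted forests

HeightAtMost : {V : Set} → RootedForest V → (V → ℕ) → ℕ → Set
HeightAtMost F w k = ∀ vs → IsVertical F vs → weightOf w vs ≤ k

module _ {V : Set} (F : RootedForest V) where

  ancestor-trans : ∀ {u v x} → Ancestor F u v → Ancestor F v x → Ancestor F u x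
  ancestor-trans u≼v self = u≼v
  ancestor-trans u≼v (up e v≼p) = up e (ancestor-trans u≼v v≼p)

  ancestor⇒≡⊎depth< : ∀ {u v} → Ancestor F u v → u ≡ v ⊎ depth F u < depth F v
  ancestor⇒≡⊎depth< self = inj₁ refl
  ancestor⇒≡⊎depth< (up e u≼p) with ancestor⇒≡⊎depth< u≼p
  ... | inj₁ refl = inj₂ (depth-parent F e)
  ... | inj₂ lt = inj₂ (<-trans lt (depth-parent F e))

  ancestors-comparable : ∀ {u v x} → Ancestor F u x → Ancestor F v x → Comparable F u v
  ancestors-comparable self v≼x = inj₂ v≼x
  ancestors-comparable (up e u≼p) self = inj₁ (up e u≼p)
  ancestors-comparable (up e u≼p) (up e′ v≼p′) with just-injective (trans (sym e) e′)
  ... | refl = ancestors-comparable u≼p v≼p′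

  ancestors⇒pairwise-comparable : ∀ {v xs} → All (λ u → Ancestor F u v) xs →
                                  AllPairs (Comparable F) xs
  ancestors⇒pairwise-comparable [] = []
  ancestors⇒pairwise-comparable (u≼v ∷ xs≼v) =
    All.map (ancestors-comparable u≼v) xs≼v ∷ ancestors⇒pairwise-comparable xs≼v

  pairwise-comparable⇒lowest : ∀ {vs} → AllPairs (Comparable F) vs →
                               vs ≡ [] ⊎ ∃ λ b → b ∈ vs × All (λ u → Ancestor F u b) vs
  pairwise-comparable⇒lowest [] = inj₁ refl
  pairwise-comparable⇒lowest {x ∷ _} (x~xs ∷ xs~) with pairwise-comparable⇒lowest xs~
  ... | inj₁ refl = inj₂ (x , here refl , self ∷ [])
  ... | inj₂ (b , b∈xs , xs≼b) with All.lookup x~xs b∈xs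
  ...   | inj₁ x≼b = inj₂ (b , there b∈xs , x≼b ∷ xs≼b)
  ...   | inj₂ b≼x = inj₂ (x , here refl , self ∷ All.map (λ u≼b → ancestor-trans u≼b b≼x) xs≼b)

  heightAtMost-viaAncestors : (w : V → ℕ) (k : ℕ) (L : V → List V) →
                              (∀ {u v} → Ancestor F u v → u ∈ L v) →
                              (∀ v → weightOf w (L v) ≤ k) → HeightAtMost F w k
  heightAtMost-viaAncestors w k L ancestors∈L L≤k vs (vs! , vs~) with pairwise-comparable⇒lowest vs~
  ... | inj₁ refl = z≤n
  ... | inj₂ (b , _ , vs≼b) =
    ≤-trans (weightOf-mono-⊆ w vs! (λ u∈vs → ancestors∈L (All.lookup vs≼b u∈vs))) (L≤k b)

  module _ (_≟_ : DecidableEquality V) where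

    ancestor? : ∀ u v → Dec (Ancestor F u v)
    ancestor? u v = go v (<-wellFounded (depth F v))
      where
      go : ∀ v → Acc _<_ (depth F v) → Dec (Ancestor F u v)
      go v (acc below) with u ≟ v
      ... | yes refl = yes self
      ... | no u≢v with parent F v in e
      ...   | nothing = no λ { self → u≢v refl ; (up e′ _) → contradiction (trans (sym e) e′) λ () }
      ...   | just p with go p (below (depth-parent F e))
      ...     | yes u≼p = yes (up e u≼p)
      ...     | no u⋠p = no λ { self → u≢v refl
                              ; (up e′ u≼p′) →
                                  u⋠p (subst (Ancestor F u) (just-injective (trans (sym e′) e)) u≼p′) }

    comparable? : ∀ u v → Dec (Comparable F u v)
    comparable? u v = ancestor? u v ⊎-dec ancestor? v u

    ancestorsOf : (vs : List V) → V → List V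
    ancestorsOf vs v = filter (λ u → ancestor? u v) vs

    ∈-ancestorsOf⁺ : ∀ {vs u v} → u ∈ vs → Ancestor F u v → u ∈ ancestorsOf vs v
    ∈-ancestorsOf⁺ {v = v} = ∈-filter⁺ (λ u → ancestor? u v)

    ancestorsOf-vertical : ∀ {vs} v → Unique vs → IsVertical F (ancestorsOf vs v)
    ancestorsOf-vertical {vs} v vs! =
      Unique.filter⁺ (λ u → ancestor? u v) vs! ,
      ancestors⇒pairwise-comparable (all-filter (λ u → ancestor? u v) vs)

ancestor-along-chain : {V : Set} (F : RootedForest V) {m : ℕ} (e : Fin m → V) →
                       (∀ {i j} → toℕ j ≡ suc (toℕ i) → parent F (e j) ≡ just (e i)) →
                       ∀ {i j} → toℕ i ≤ toℕ j → Ancestor F (e i) (e j)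
ancestor-along-chain F {m} e parent≡previous {i} i≤j = go _ (sym (m∸n+n≡m i≤j))
  where
  go : ∀ d {j} → toℕ j ≡ d + toℕ i → Ancestor F (e i) (e j)
  go zero {j} j≡i with Finₚ.toℕ-injective {i = j} {i} j≡i
  ... | refl = self
  go (suc d) {j} j≡1+d+i = up (parent≡previous (trans j≡1+d+i (cong suc (sym toℕ-j′)))) (go d toℕ-j′)
    where
    d+i<m : d + toℕ i < m
    d+i<m = <⇒≤ (subst (_< m) j≡1+d+i (Finₚ.toℕ<n j))
    toℕ-j′ : toℕ (fromℕ< d+i<m) ≡ d + toℕ i
    toℕ-j′ = Finₚ.toℕ-fromℕ< d+i<m

module _ {V : Set} {F F′ : RootedForest V} (same : ∀ v → parent F v ≡ parent F′ v) where

  ancestor-resp-parent : ∀ {u v} → Ancestor F u v → Ancestor F′ u v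
  ancestor-resp-parent self = self
  ancestor-resp-parent {v = v} (up e u≼p) = up (trans (sym (same v)) e) (ancestor-resp-parent u≼p)

  comparable-resp-parent : ∀ {u v} → Comparable F u v → Comparable F′ u v
  comparable-resp-parent (inj₁ u≼v) = inj₁ (ancestor-resp-parent u≼v)
  comparable-resp-parent (inj₂ v≼u) = inj₂ (ancestor-resp-parent v≼u)

  isTDDecomp-resp-parent : ∀ {G : Graph V} → IsTDDecomp G F → IsTDDecomp G F′
  isTDDecomp-resp-parent decomp u~v = comparable-resp-parent (decomp u~v)

heightAtMost-resp-parent : {V : Set} {F F′ : RootedForest V} → (∀ v → parent F v ≡ parent F′ v) →
                           ∀ {w k} → HeightAtMost F w k → HeightAtMost F′ w k
heightAtMost-resp-parent same bounded vs (vs! , vs~) =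
  bounded vs (vs! , AllPairs.map (comparable-resp-parent (sym ∘ same)) vs~)

-- Adjacency in acyclic connected graphs

module _ {V : Set} (_≟_ : DecidableEquality V) (G : Graph V) where
  open import Data.List.Membership.DecPropositional _≟_ using (_∈?_)

  IsPath : V → List V → V → Set
  IsPath u vs x = Unique (u ∷ vs) × Consec G (u ∷ vs) × last u vs ≡ x

  path-suffix : ∀ {u s vs x} → u ∈ s ∷ vs → IsPath s vs x → ∃ λ suf → IsPath u suf x
  path-suffix {vs = vs} (here refl) path = vs , path
  path-suffix {vs = _ ∷ _} (there u∈vs) (_ ∷ vs! , (_ , consec) , end) = path-suffix u∈vs (vs! , consec , end)

  walk⇒path : ∀ {u x} → Walk G u x → ∃ λ vs → IsPath u vs x
  walk⇒path here = [] , ([] ∷ []) , _ , refl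
  walk⇒path {u} (step {v = v} u~v walk) with vs , vs! , consec , end ← walk⇒path walk | u ∈? (v ∷ vs)
  ... | yes u∈path = path-suffix u∈path (vs! , consec , end)
  ... | no u∉path = v ∷ vs , (¬Any⇒All¬ (v ∷ vs) u∉path ∷ vs!) , (u~v , consec) , end

  adjacent? : Connected G → Acyclic G → ∀ u v → Dec (Adj G u v)
  adjacent? connected acyclic u v with u ≟ v | walk⇒path (connected u v)
  ... | yes refl | _ = no (irrefl G)
  ... | no u≢v | [] , _ , _ , refl = contradiction refl u≢v
  ... | no _ | _ ∷ [] , _ , (u~v , _) , refl = yes u~v
  ... | no _ | z ∷ z′ ∷ zs , path! , consec , end =
    no λ u~v → acyclic u (z ∷ z′ ∷ zs)
                 (path! , s≤s (s≤s z≤n) , consec , subst (λ y → Adj G y u) (sym end) (Graph.sym G u~v))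

-- Deciding td(G, w) ≤ k

∃-fun? : ∀ {m n} {P : (Fin m → Fin n) → Set} → (∀ {f g} → f ≗ g → P f → P g) →
         (∀ f → Dec (P f)) → Dec (∃ P)
∃-fun? {P = P} resp P? with Finₚ.any? (λ i → P? (finToFun i))
... | yes (i , Pf) = yes (finToFun i , Pf)
... | no ∄i = no λ (f , Pf) → ∄i (funToFin f , resp (λ i → sym (Finₚ.finToFun-funToFin f i)) Pf)

module _ {n : ℕ} (F : RootedForest (Fin n)) where

  shallower : ℕ → List (Fin n)
  shallower x = filter (λ u → depth F u <? x) (allFin n)

  ∈-shallower⁺ : ∀ {u x} → depth F u < x → u ∈ shallower x
  ∈-shallower⁺ {u} {x} = ∈-filter⁺ (λ u → depth F u <? x) (∈-allFin u)

  ∈-shallower⁻ : ∀ {u x} → u ∈ shallower x → depth F u < x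
  ∈-shallower⁻ {x = x} u∈ = proj₂ (∈-filter⁻ (λ u → depth F u <? x) {xs = allFin n} u∈)

  countShallower : ℕ → ℕ
  countShallower x = length (shallower x)

  countShallower-< : ∀ v → countShallower (depth F v) < n
  countShallower-< v = subst (countShallower (depth F v) <_) (length-tabulate {n = n} (λ i → i))
    (filter-notAll (λ u → depth F u <? depth F v) (allFin n)
      (Any.map (λ { refl → <-irrefl refl }) (∈-allFin v)))

  countShallower-mono-< : ∀ {u v} → depth F u < depth F v →
                          countShallower (depth F u) < countShallower (depth F v)
  countShallower-mono-< {u} {v} du<dv = length-mono-⊆ u∷shallower! u∷shallower⊆
    where
    u∷shallower! : Unique (u ∷ shallower (depth F u))
    u∷shallower! =
      All.tabulate (λ u′∈ u≡u′ → <-irrefl (cong (depth F) (sym u≡u′)) (∈-shallower⁻ u′∈))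
                 ∷ Unique.filter⁺ (λ u′ → depth F u′ <? depth F u) (Unique.allFin⁺ n)
    u∷shallower⊆ : u ∷ shallower (depth F u) ⊆ shallower (depth F v)
    u∷shallower⊆ (here refl) = ∈-shallower⁺ du<dv
    u∷shallower⊆ (there u′∈) = ∈-shallower⁺ (<-trans (∈-shallower⁻ u′∈) du<dv)

  depthRank : Fin n → Fin n
  depthRank v = fromℕ< (countShallower-< v)

  depthRank-mono-< : ∀ {u v} → depth F u < depth F v → toℕ (depthRank u) < toℕ (depthRank v)
  depthRank-mono-< {u} {v} du<dv =
    subst₂ _<_ (sym (Finₚ.toℕ-fromℕ< (countShallower-< u))) (sym (Finₚ.toℕ-fromℕ< (countShallower-< v)))
      (countShallower-mono-< du<dv)

justIf : {A P : Set} → Dec P → A → Maybe A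
justIf (yes _) u = just u
justIf (no _) u = nothing

module _ {n : ℕ} where

  linkIfShallower : (Fin n → Fin n) → Fin n → Fin (suc n) → Maybe (Fin n)
  linkIfShallower d v Fin.zero = nothing
  linkIfShallower d v (Fin.suc u) = justIf (toℕ (d u) <? toℕ (d v)) u

  linkIfShallower-< : ∀ d v i {u} → linkIfShallower d v i ≡ just u → toℕ (d u) < toℕ (d v)
  linkIfShallower-< d v (Fin.suc u) e with toℕ (d u) <? toℕ (d v)
  linkIfShallower-< d v (Fin.suc u) refl | yes du<dv = du<dv

  linkIfShallower-cong : ∀ {d d′} → d ≗ d′ → ∀ v i → linkIfShallower d v i ≡ linkIfShallower d′ v i
  linkIfShallower-cong d≗d′ v Fin.zero = refl
  linkIfShallower-cong d≗d′ v (Fin.suc u) =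
    cong₂ (λ a b → justIf (toℕ a <? toℕ b) u) (d≗d′ u) (d≗d′ v)

  -- A parent link is dropped unless it decreases the depth code, so every pair of functions
  -- decodes to a forest and the search can range over all of them.
  decode : (Fin n → Fin (suc n)) → (Fin n → Fin n) → RootedForest (Fin n)
  decode p d = record
    { parent = λ v → linkIfShallower d v (p v)
    ; depth = λ v → toℕ (d v)
    ; depth-parent = λ {_} {v} → linkIfShallower-< d v (p v)
    }

  decode-cong : ∀ {p p′ d d′} → p ≗ p′ → d ≗ d′ →
                ∀ v → parent (decode p d) v ≡ parent (decode p′ d′) v
  decode-cong {p′ = p′} {d = d} p≗p′ d≗d′ v =
    trans (cong (linkIfShallower d v) (p≗p′ v)) (linkIfShallower-cong d≗d′ v (p′ v))

  encodeParent : Maybe (Fin n) → Fin (suc n)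
  encodeParent nothing = Fin.zero
  encodeParent (just u) = Fin.suc u

  decode-encode : (F : RootedForest (Fin n)) →
                  ∀ v → parent (decode (encodeParent ∘ parent F) (depthRank F)) v ≡ parent F v
  decode-encode F v with parent F v in e
  ... | nothing = refl
  ... | just u with toℕ (depthRank F u) <? toℕ (depthRank F v)
  ...   | yes _ = refl
  ...   | no ¬r<r = contradiction (depthRank-mono-< F (depth-parent F e)) ¬r<r

module _ {n : ℕ} (F : RootedForest (Fin n)) where

  isTDDecomp? : (G : Graph (Fin n)) → (∀ u v → Dec (Adj G u v)) → Dec (IsTDDecomp G F)
  isTDDecomp? G adj? = Dec.map′ (λ decomp {u} {v} → decomp u v) (λ decomp u v → decomp)
    (Finₚ.all? λ u → Finₚ.all? λ v → adj? u v →-dec comparable? F Finₚ._≟_ u v)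

  heightAtMost? : (w : Fin n → ℕ) (k : ℕ) → Dec (HeightAtMost F w k)
  heightAtMost? w k = Dec.map′
    (heightAtMost-viaAncestors F w k ancestors (λ u≼v → ∈-ancestorsOf⁺ F Finₚ._≟_ (∈-allFin _) u≼v))
    (λ bounded v → bounded (ancestors v) (ancestorsOf-vertical F Finₚ._≟_ v (Unique.allFin⁺ n)))
    (Finₚ.all? λ v → weightOf w (ancestors v) ≤? k)
    where
    ancestors : Fin n → List (Fin n)
    ancestors = ancestorsOf F Finₚ._≟_ (allFin n)

tdAtMost? : ∀ {n} (G : Graph (Fin n)) → (∀ u v → Dec (Adj G u v)) → (w : Fin n → ℕ) (k : ℕ) →
            Dec (TDAtMost G w k)
tdAtMost? {n} G adj? w k = Dec.map′
  (λ (p , d , bounded) → decode p d , bounded)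
  (λ (F , bounded) → encodeParent ∘ parent F , depthRank F ,
                     resp-parent (sym ∘ decode-encode F) bounded)
  (∃-fun? (λ p≗p′ (d , bounded) → d , resp-parent (decode-cong p≗p′ (λ _ → refl)) bounded) λ p →
   ∃-fun? (λ d≗d′ bounded → resp-parent (decode-cong {p = p} (λ _ → refl) d≗d′) bounded) λ d →
   isTDDecomp? (decode p d) G adj? ×-dec heightAtMost? (decode p d) w k)
  where
  resp-parent : ∀ {F F′} → (∀ v → parent F v ≡ parent F′ v) →
                IsTDDecomp G F × HeightAtMost F w k → IsTDDecomp G F′ × HeightAtMost F′ w k
  resp-parent same (decomp , bounded) =
    isTDDecomp-resp-parent same {G = G} decomp , heightAtMost-resp-parent same bounded

Least : (ℕ → Set) → ℕ → Set
Least Q t = Q t × (∀ k′ → Q k′ → t ≤ k′)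

module _ {Q : ℕ → Set} (Q? : ∀ k → Dec (Q k)) where

  least : ∀ {k} → Q k → ∃ (Least Q)
  least {k} Qk = search k 0 (λ ()) (subst Q (sym (+-identityʳ k)) Qk)
    where
    search : ∀ gap i → (∀ {j} → j < i → ¬ Q j) → Q (gap + i) → ∃ (Least Q)
    search gap i ¬Q<i Q[gap+i] with Q? i | gap
    ... | yes Qi | _ = i , Qi , λ k′ Qk′ → ≮⇒≥ λ k′<i → ¬Q<i k′<i Qk′
    ... | no ¬Qi | zero = contradiction Q[gap+i] ¬Qi
    ... | no ¬Qi | suc gap′ = search gap′ (suc i) ¬Q<1+i (subst Q (sym (+-suc gap′ i)) Q[gap+i])
      where
      ¬Q<1+i : ∀ {j} → j < suc i → ¬ Q j
      ¬Q<1+i j<1+i with m<1+n⇒m<n∨m≡n j<1+i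
      ... | inj₁ j<i = ¬Q<i j<i
      ... | inj₂ refl = ¬Qi

pathForest : ∀ n → RootedForest (Fin n)
pathForest n = record { parent = predecessor ; depth = toℕ ; depth-parent = predecessor-< }
  where
  predecessor : Fin n → Maybe (Fin n)
  predecessor Fin.zero = nothing
  predecessor (Fin.suc i) = just (Fin.inject₁ i)
  predecessor-< : ∀ {i j} → predecessor j ≡ just i → toℕ i < toℕ j
  predecessor-< {j = Fin.suc i} refl = s≤s (≤-reflexive (Finₚ.toℕ-inject₁ i))

pathForest-ancestor : ∀ {n} {i j : Fin n} → toℕ i ≤ toℕ j → Ancestor (pathForest n) i j
pathForest-ancestor {n} = ancestor-along-chain (pathForest n) id predecessor-step
  where
  predecessor-step : ∀ {i j : Fin n} → toℕ j ≡ suc (toℕ i) → parent (pathForest n) j ≡ just i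
  predecessor-step {j = Fin.suc j} j≡1+i =
    cong just (Finₚ.toℕ-injective (trans (Finₚ.toℕ-inject₁ j) (suc-injective j≡1+i)))

tdAtMost-totalWeight : ∀ {n} (G : Graph (Fin n)) (w : Fin n → ℕ) → TDAtMost G w (weightOf w (allFin n))
tdAtMost-totalWeight {n} G w = pathForest n , (λ {u} {v} _ → comparable u v) ,
  λ vs (vs! , _) → weightOf-mono-⊆ w vs! (λ {v} _ → ∈-allFin v)
  where
  comparable : ∀ u v → Comparable (pathForest n) u v
  comparable u v with ≤-total (toℕ u) (toℕ v)
  ... | inj₁ u≤v = inj₁ (pathForest-ancestor u≤v)
  ... | inj₂ v≤u = inj₂ (pathForest-ancestor v≤u)

-- The blow-up G_M(T, w)

toℕ-pred : ∀ {m} (j : Fin m) → toℕ (Fin.pred j) ≡ ℕ.pred (toℕ j)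
toℕ-pred Fin.zero = refl
toℕ-pred (Fin.suc i) = Finₚ.toℕ-inject₁ i

module Blocks {n : ℕ} (w : Fin n → ℕ) (M : ℕ) where

  size : Fin n → ℕ
  size x = w x * M

  block : (x : Fin n) → List (GM-V w M)
  block x = map (x ,_) (allFin (size x))

  blocks : List (Fin n) → List (GM-V w M)
  blocks = concatMap block

  ∈-blocks⁺ : ∀ {x xs} (i : Fin (size x)) → x ∈ xs → (x , i) ∈ blocks xs
  ∈-blocks⁺ {x} i x∈xs =
    ∈-concatMap⁺ block (Any.map (λ { refl → ∈-map⁺ (x ,_) (∈-allFin i) }) x∈xs)

  ∈-block⁻ : ∀ {a x} → a ∈ block x → proj₁ a ≡ x
  ∈-block⁻ a∈ with _ , _ , refl ← ∈-map⁻ (_ ,_) a∈ = refl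

  ∈-blocks⁻ : ∀ {a xs} → a ∈ blocks xs → proj₁ a ∈ xs
  ∈-blocks⁻ a∈ = Any.map ∈-block⁻ (∈-concatMap⁻ block a∈)

  length-block : ∀ x → length (block x) ≡ size x
  length-block x = trans (length-map {B = GM-V w M} (x ,_) (allFin (size x))) (length-tabulate {n = size x} id)

  blocks-unique : ∀ {xs} → Unique xs → Unique (blocks xs)
  blocks-unique {[]} [] = []
  blocks-unique {x ∷ xs} (x∉xs ∷ xs!) =
    Unique.++⁺ (Unique.map⁺ (λ { refl → refl }) (Unique.allFin⁺ (size x))) (blocks-unique xs!)
      λ (a∈block , a∈blocks) → All.lookup x∉xs (∈-blocks⁻ a∈blocks) (sym (∈-block⁻ a∈block))

  weightOf-blocks : ∀ xs → weightOf (λ _ → 1) (blocks xs) ≡ weightOf w xs * M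
  weightOf-blocks [] = refl
  weightOf-blocks (x ∷ xs) = begin
    weightOf (λ _ → 1) (block x ++ blocks xs)
      ≡⟨ weightOf-++ (λ _ → 1) (block x) (blocks xs) ⟩
    weightOf (λ _ → 1) (block x) + weightOf (λ _ → 1) (blocks xs)
      ≡⟨ cong₂ _+_ (trans (weightOf-const (block x)) (length-block x)) (weightOf-blocks xs) ⟩
    w x * M + weightOf w xs * M
      ≡⟨ *-distribʳ-+ M (w x) (weightOf w xs) ⟨
    (w x + weightOf w xs) * M
      ∎
    where open ≡-Reasoning

module Expand {n : ℕ} (w : Fin n → ℕ) (M : ℕ) (nonempty : ∀ x → 0 < w x * M)
              (F : RootedForest (Fin n)) where
  open Blocks w M

  top : ∀ x → Fin (size x)
  top x = fromℕ< (nonempty x)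

  bottom : ∀ x → Fin (size x)
  bottom x = fromℕ< (≤-reflexive (suc-pred (size x) {{>-nonZero (nonempty x)}}))

  ≤bottom : ∀ {x} (j : Fin (size x)) → toℕ j ≤ toℕ (bottom x)
  ≤bottom j = subst (toℕ j ≤_) (sym (Finₚ.toℕ-fromℕ< _)) (Finₚ.toℕ≤pred[n] j)

  totalSize : ℕ
  totalSize = weightOf size (allFin n)

  index<totalSize : ∀ {x} (j : Fin (size x)) → toℕ j < totalSize
  index<totalSize {x} j = <-≤-trans (Finₚ.toℕ<n j) (∈⇒≤weightOf size (∈-allFin x))

  -- V_x becomes a chain with index 0 on top, hung below the bottom vertex of the block of
  -- x's parent; totalSize exceeds every index, so depth F x * totalSize separates the levels.
  expandedParent : GM-V w M → Maybe (GM-V w M)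
  expandedParent (x , j) with toℕ j
  ... | zero = Maybe.map (λ p → p , bottom p) (parent F x)
  ... | suc _ = just (x , Fin.pred j)

  expandedDepth : GM-V w M → ℕ
  expandedDepth (x , j) = depth F x * totalSize + toℕ j

  expandedDepth-parent : ∀ {u v} → expandedParent v ≡ just u → expandedDepth u < expandedDepth v
  expandedDepth-parent {u} {x , j} e with toℕ j in j≡
  expandedDepth-parent {u} {x , j} e | zero with parent F x in px
  expandedDepth-parent {u} {x , j} refl | zero | just p = begin-strict
    depth F p * totalSize + toℕ (bottom p)  <⟨ +-monoʳ-< (depth F p * totalSize) (index<totalSize (bottom p)) ⟩
    depth F p * totalSize + totalSize       ≡⟨ +-comm (depth F p * totalSize) totalSize ⟩
    suc (depth F p) * totalSize             ≤⟨ *-monoˡ-≤ totalSize (depth-parent F px) ⟩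
    depth F x * totalSize                   ≡⟨ +-identityʳ _ ⟨
    depth F x * totalSize + 0               ∎
    where open ≤-Reasoning
  expandedDepth-parent {u} {x , j} refl | suc i =
    +-monoʳ-< (depth F x * totalSize) (≤-reflexive (cong suc (trans (toℕ-pred j) (cong ℕ.pred j≡))))

  expanded : RootedForest (GM-V w M)
  expanded = record
    { parent = expandedParent ; depth = expandedDepth ; depth-parent = expandedDepth-parent }

  expandedParent-inBlock : ∀ {x} {i j : Fin (size x)} → toℕ j ≡ suc (toℕ i) →
                           expandedParent (x , j) ≡ just (x , i)
  expandedParent-inBlock {x} {i} {j} j≡1+i rewrite j≡1+i =
    cong (λ k → just (x , k)) (Finₚ.toℕ-injective (trans (toℕ-pred j) (cong ℕ.pred j≡1+i)))

  expandedParent-top : ∀ {x p} → parent F x ≡ just p →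
                       expandedParent (x , top x) ≡ just (p , bottom p)
  expandedParent-top {x} px rewrite Finₚ.toℕ-fromℕ< (nonempty x) | px = refl

  expandedParent-proj₁ : ∀ {x y} {i : Fin (size y)} {j : Fin (size x)} →
                         expandedParent (x , j) ≡ just (y , i) → y ≡ x ⊎ parent F x ≡ just y
  expandedParent-proj₁ {x} {j = j} e with toℕ j
  expandedParent-proj₁ {x} {j = j} refl | suc _ = inj₁ refl
  expandedParent-proj₁ {x} {j = j} e | zero with parent F x
  expandedParent-proj₁ {x} {j = j} refl | zero | just p = inj₂ refl

  inBlock-ancestor : ∀ {x} {i j : Fin (size x)} → toℕ i ≤ toℕ j → Ancestor expanded (x , i) (x , j)
  inBlock-ancestor {x} = ancestor-along-chain expanded (x ,_) expandedParent-inBlock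

  parentBottom-ancestor : ∀ {x p} → parent F x ≡ just p →
                          ∀ j → Ancestor expanded (p , bottom p) (x , j)
  parentBottom-ancestor {x} px j =
    ancestor-trans expanded (up (expandedParent-top px) self)
      (inBlock-ancestor (subst (_≤ toℕ j) (sym (Finₚ.toℕ-fromℕ< (nonempty x))) z≤n))

  block-ancestor : ∀ {y p x} → Ancestor F y p → parent F x ≡ just p →
                   ∀ i j → Ancestor expanded (y , i) (x , j)
  block-ancestor self px i j =
    ancestor-trans expanded (inBlock-ancestor (≤bottom i)) (parentBottom-ancestor px j)
  block-ancestor (up pp y≼p′) px i j =
    ancestor-trans expanded (block-ancestor y≼p′ pp i _) (parentBottom-ancestor px j)

  project-ancestor : ∀ {a b} → Ancestor expanded a b → Ancestor F (proj₁ a) (proj₁ b)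
  project-ancestor self = self
  project-ancestor {b = x , j} (up {p = y , _} e a≼p) with expandedParent-proj₁ {x} {y} {j = j} e
  ... | inj₁ refl = project-ancestor a≼p
  ... | inj₂ px = up px (project-ancestor a≼p)

  expanded-decomposes : ∀ {T} → IsTDDecomp T F → IsTDDecomp (GM T w M) expanded
  expanded-decomposes decomp {x , i} {.x , j} (inj₁ (refl , _)) with ≤-total (toℕ i) (toℕ j)
  ... | inj₁ i≤j = inj₁ (inBlock-ancestor i≤j)
  ... | inj₂ j≤i = inj₂ (inBlock-ancestor j≤i)
  expanded-decomposes {T} decomp {x , i} {y , j} (inj₂ x~y) with decomp x~y
  ... | inj₁ self = contradiction x~y (irrefl T)
  ... | inj₂ self = contradiction x~y (irrefl T)
  ... | inj₁ (up py x≼p) = inj₁ (block-ancestor x≼p py i j)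
  ... | inj₂ (up px y≼p) = inj₂ (block-ancestor y≼p px j i)

  expanded-height : ∀ {t} → HeightAtMost F w t → HeightAtMost expanded (λ _ → 1) (M * t)
  expanded-height {t} bounded = heightAtMost-viaAncestors expanded (λ _ → 1) (M * t)
    (blocks ∘ ancestors ∘ proj₁)
    (λ {a} a≼b →
      ∈-blocks⁺ (proj₂ a) (∈-ancestorsOf⁺ F Finₚ._≟_ (∈-allFin _) (project-ancestor a≼b)))
    λ (x , _) → begin
      weightOf (λ _ → 1) (blocks (ancestors x)) ≡⟨ weightOf-blocks (ancestors x) ⟩
      weightOf w (ancestors x) * M              ≤⟨ *-monoˡ-≤ M (bounded _ (ancestors-vertical x)) ⟩
      t * M                                     ≡⟨ *-comm t M ⟩
      M * t                                     ∎
    where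
    open ≤-Reasoning
    ancestors : Fin n → List (Fin n)
    ancestors = ancestorsOf F Finₚ._≟_ (allFin n)
    ancestors-vertical : ∀ x → IsVertical F (ancestors x)
    ancestors-vertical x = ancestorsOf-vertical F Finₚ._≟_ x (Unique.allFin⁺ n)

blowUp-tdAtMost : ∀ {n} (T : Graph (Fin n)) (w : Fin n → ℕ) (M : ℕ) → (∀ x → 0 < w x * M) →
                  ∀ {t} → TDAtMost T w t → TDAtMost (GM T w M) (λ _ → 1) (M * t)
blowUp-tdAtMost T w M nonempty (F , decomp , bounded) =
  expanded , expanded-decomposes {T} decomp , expanded-height bounded
  where open Expand w M nonempty F

module Contract {n : ℕ} (T : Graph (Fin n)) (w : Fin n → ℕ) (M : ℕ) (nonempty : ∀ x → 0 < w x * M)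
                (F′ : RootedForest (GM-V w M)) (decomp′ : IsTDDecomp (GM T w M) F′) where
  open Blocks w M

  _≟ᴳ_ : DecidableEquality (GM-V w M)
  _≟ᴳ_ = ≡-dec Finₚ._≟_ Finₚ._≟_

  lowest : Fin n → GM-V w M
  lowest x = x , argmax (λ j → depth F′ (x , j)) (fromℕ< (nonempty x)) (allFin (size x))

  lowest-deepest : ∀ x j → depth F′ (x , j) ≤ depth F′ (lowest x)
  lowest-deepest x j =
    All.lookup (f[xs]≤f[argmax] {f = λ j → depth F′ (x , j)} _ (allFin (size x))) (∈-allFin j)

  -- V_x is a clique, hence a chain in F′.
  ancestor-lowest : ∀ x j → Ancestor F′ (x , j) (lowest x)
  ancestor-lowest x j with (x , j) ≟ᴳ lowest x
  ... | yes xj≡lowest = subst (Ancestor F′ (x , j)) xj≡lowest self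
  ... | no xj≢lowest with decomp′ (inj₁ (refl , xj≢lowest))
  ...   | inj₁ xj≼lowest = xj≼lowest
  ...   | inj₂ lowest≼xj with ancestor⇒≡⊎depth< F′ lowest≼xj
  ...     | inj₁ lowest≡xj = contradiction (sym lowest≡xj) xj≢lowest
  ...     | inj₂ deeper = contradiction (lowest-deepest x j) (<⇒≱ deeper)

  depthOfLowest : Fin n → ℕ
  depthOfLowest x = depth F′ (lowest x)

  StrictlyAbove : Fin n → Fin n → Set
  StrictlyAbove y x = y ≢ x × Ancestor F′ (lowest y) (lowest x)

  strictlyAbove⇒depth< : ∀ {y x} → StrictlyAbove y x → depthOfLowest y < depthOfLowest x
  strictlyAbove⇒depth< (y≢x , y≼x) with ancestor⇒≡⊎depth< F′ y≼x
  ... | inj₁ lowest≡ = contradiction (cong proj₁ lowest≡) y≢x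
  ... | inj₂ shallower = shallower

  strictlyAbove? : ∀ x y → Dec (StrictlyAbove y x)
  strictlyAbove? x y = Dec.¬? (y Finₚ.≟ x) ×-dec ancestor? F′ _≟ᴳ_ (lowest y) (lowest x)

  above : Fin n → List (Fin n)
  above x = filter (strictlyAbove? x) (allFin n)

  ∈-above⁺ : ∀ {y x} → StrictlyAbove y x → y ∈ above x
  ∈-above⁺ {y} {x} = ∈-filter⁺ (strictlyAbove? x) (∈-allFin y)

  ∈-above⁻ : ∀ {y x} → y ∈ above x → StrictlyAbove y x
  ∈-above⁻ {x = x} y∈ = proj₂ (∈-filter⁻ (strictlyAbove? x) {xs = allFin n} y∈)

  contractedParent : Fin n → Maybe (Fin n)
  contractedParent x = argmaxᴹ depthOfLowest (above x)

  parent-strictlyAbove : ∀ {x z} → contractedParent x ≡ just z → StrictlyAbove z x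
  parent-strictlyAbove pz = ∈-above⁻ (argmaxᴹ-∈ depthOfLowest pz)

  contracted : RootedForest (Fin n)
  contracted = record
    { parent = contractedParent
    ; depth = depthOfLowest
    ; depth-parent = λ pz → strictlyAbove⇒depth< (parent-strictlyAbove pz)
    }

  contracted-ancestor⁺ : ∀ {y x} → Ancestor contracted y x → Ancestor F′ (lowest y) (lowest x)
  contracted-ancestor⁺ self = self
  contracted-ancestor⁺ (up pz y≼z) =
    ancestor-trans F′ (contracted-ancestor⁺ y≼z) (proj₂ (parent-strictlyAbove pz))

  strictlyAbove⇒ancestor-parent : ∀ {y x z} → StrictlyAbove y x → contractedParent x ≡ just z →
                                  Ancestor F′ (lowest y) (lowest z)
  strictlyAbove⇒ancestor-parent y>x pz
    with ancestors-comparable F′ (proj₂ y>x) (proj₂ (parent-strictlyAbove pz))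
  ... | inj₁ y≼z = y≼z
  ... | inj₂ z≼y with ancestor⇒≡⊎depth< F′ z≼y
  ...   | inj₁ z≡y = subst (Ancestor F′ (lowest _)) (sym z≡y) self
  ...   | inj₂ deeper = contradiction (argmaxᴹ-maximal depthOfLowest pz (∈-above⁺ y>x)) (<⇒≱ deeper)

  contracted-ancestor⁻ : ∀ {y x} → Ancestor F′ (lowest y) (lowest x) → Ancestor contracted y x
  contracted-ancestor⁻ {y} {x} = go x (<-wellFounded (depthOfLowest x))
    where
    go : ∀ x → Acc _<_ (depthOfLowest x) → Ancestor F′ (lowest y) (lowest x) → Ancestor contracted y x
    go x (acc shallower) y≼x with y Finₚ.≟ x
    ... | yes refl = self
    ... | no y≢x with z , pz ← argmaxᴹ-just depthOfLowest (∈-above⁺ (y≢x , y≼x)) =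
      up pz (go z (shallower (depth-parent contracted pz))
                  (strictlyAbove⇒ancestor-parent (y≢x , y≼x) pz))

  contracted-decomposes : IsTDDecomp T contracted
  contracted-decomposes x~y with decomp′ {lowest _} {lowest _} (inj₂ x~y)
  ... | inj₁ x≼y = inj₁ (contracted-ancestor⁻ x≼y)
  ... | inj₂ y≼x = inj₂ (contracted-ancestor⁻ y≼x)

  contracted-height : ∀ {k} → HeightAtMost F′ (λ _ → 1) k →
                      ∀ xs → IsVertical contracted xs → weightOf w xs * M ≤ k
  contracted-height bounded xs (xs! , xs~) with pairwise-comparable⇒lowest contracted xs~
  ... | inj₁ refl = z≤n
  ... | inj₂ (b , _ , xs≼b) = subst (_≤ _) (weightOf-blocks xs)
    (bounded (blocks xs)
      (blocks-unique xs! , ancestors⇒pairwise-comparable F′ (All.tabulate below-lowest-b)))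
    where
    below-lowest-b : ∀ {a} → a ∈ blocks xs → Ancestor F′ a (lowest b)
    below-lowest-b {x , j} a∈ =
      ancestor-trans F′ (ancestor-lowest x j)
        (contracted-ancestor⁺ (All.lookup xs≼b (∈-blocks⁻ a∈)))

contract-tdAtMost : ∀ {n} (T : Graph (Fin n)) (w : Fin n → ℕ) (M : ℕ) .{{_ : NonZero M}} →
                    (∀ x → 0 < w x * M) →
                    ∀ {k} → TDAtMost (GM T w M) (λ _ → 1) k → TDAtMost T w (k / M)
contract-tdAtMost T w M nonempty {k} (F′ , decomp′ , bounded′) =
  contracted , contracted-decomposes ,
  λ xs vertical → subst (_≤ k / M) (m*n/n≡m (weightOf w xs) M)
                         (/-monoˡ-≤ M (contracted-height bounded′ xs vertical))
  where open Contract T w M nonempty F′ decomp′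

mainTheorem4 : ∀ {n} (T : Graph (Fin n)) → IsTree T →
    (w : Fin n → ℕ) → (∀ x → 1 ≤ w x) →
    (M : ℕ) → 1 ≤ M →
    Σ ℕ λ t → IsWeightedTD T w t × IsTD (GM T w M) (M * t)
mainTheorem4 T (connected , acyclic) w w≥1 M M≥1
  with t , tdAtMost-t , t-least ← least (tdAtMost? T (adjacent? Finₚ._≟_ T connected acyclic) w)
                                        (tdAtMost-totalWeight T w)
  = t , (tdAtMost-t , t-least) , (blowUp-tdAtMost T w M nonempty tdAtMost-t , M*t-least)
  where
  instance
    M≢0 : NonZero M
    M≢0 = >-nonZero M≥1

  nonempty : ∀ x → 0 < w x * M
  nonempty x = *-mono-≤ (w≥1 x) M≥1

  M*t-least : ∀ k → TDAtMost (GM T w M) (λ _ → 1) k → M * t ≤ k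
  M*t-least k tdAtMost-k = begin
    M * t        ≤⟨ *-monoʳ-≤ M (t-least (k / M) (contract-tdAtMost T w M nonempty tdAtMost-k)) ⟩
    M * (k / M)  ≡⟨ *-comm M (k / M) ⟩
    k / M * M    ≤⟨ m/n*n≤m k M ⟩
    k            ∎
    where open ≤-Reasoning
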